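{- Let $\vdash$ and $\vdash'$ be logics and $\boldsymbol\tau$ a translation of $\mathcal L_\vdash$ into $\mathcal L_{\vdash'}$. Then $\boldsymbol\tau$ is an interpretation of $\vdash$ into $\vdash'$ if and only if $\langle\mathbf A^{\boldsymbol\tau},F\rangle\in\mathrm{Mod}^{\equiv}(\vdash)$ for every $\langle\mathbf A,F\rangle\in\mathbb R(\mathrm{Mod}(\vdash'))$.
   Context: Languages are algebraic similarity types with no nullary symbols. Fix a proper class of variables $\{x_\alpha:\alpha\text{ an ordinal}\}$; $Fm_{\mathcal L}(\kappa)$ is the set/algebra of $\mathcal L$-formulas in variables $\{x_\alpha:\alpha<\kappa\}$ ($\kappa$ infinite). A logic $\vdash$ is a substitution-invariant consequence relation on some $Fm_{\mathcal L}(\kappa)$; $\mathcal L_\vdash:=\mathcal L$, $Fm(\vdash):=Fm_{\mathcal L}(\kappa)$. A matrix is a pair $\langle\mathbf A,F\rangle$, $F\subseteq A$; matrices are isomorphic if an algebra isomorphism maps one filter onto the other. $F$ is a deductive filter of $\vdash$ on $\mathbf A$ if whenever $\Gamma\vdash\varphi$ and $h:\mathbf{Fm}(\vdash)\to\mathbf A$ is a homomorphism with $h[\Gamma]\subseteq F$, then $h(\varphi)\in F$; then $\langle\mathbf A,F\rangle$ is a model; $\mathrm{Mod}(\vdash)$ is the class of models. $\Omega^{\mathbf A}F$ is the largest congruence of $\mathbf A$ compatible with $F$ ($\langle a,b\rangle\in\theta$, $a\in F$ imply $b\in F$); $\widetilde\Omega^{\mathbf A}_\vdash F:=\bigcap\{\Omega^{\mathbf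 A}G: G\supseteq F\text{ a deductive filter of }\vdash\text{ on }\mathbf A\}$; $\mathrm{Mod}^{\equiv}(\vdash)$ is the class of models with $\widetilde\Omega^{\mathbf A}_\vdash F$ the identity. For a class $\mathsf K$ of matrices, $\mathbb R(\mathsf K)$ is the class of matrices isomorphic to $\langle\mathbf A/\Omega^{\mathbf A}F,F/\Omega^{\mathbf A}F\rangle$ for some $\langle\mathbf A,F\rangle\in\mathsf K$. A translation $\boldsymbol\tau$ of $\mathcal L$ into $\mathcal L'$ assigns to each $n$-ary symbol $*$ of $\mathcal L$ an $\mathcal L'$-formula $\boldsymbol\tau(*)$ in $x_1,\dots,x_n$; for an $\mathcal L'$-algebra $\mathbf A$, $\mathbf A^{\boldsymbol\tau}$ is the $\mathcal L$-algebra on $A$ with $*^{\mathbf A^{\boldsymbol\tau}}:=\boldsymbol\tau(*)^{\mathbf A}$. An interpretation of $\vdash$ into $\vdash'$ is a translation $\boldsymbol\tau$ of $\mathcal L_\vdash$ into $\mathcal L_{\vdash'}$ such that $\langle\mathbf A^{\boldsymbol\tau},F\rangle\in\mathrm{Mod}^{\equiv}(\vdash)$ for every $\langle\mathbf A,F\rangle\in\mathrm{Mod}^{\equiv}(\vdash')$. -}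

module Defs where

open import Level using (Level; 0ℓ; _⊔_) renaming (suc to lsuc)
open import Data.Nat using (ℕ; _≤_)
open import Data.Fin using (Fin; zero; suc)
open import Data.Vec using (Vec; []; _∷_; lookup; map)
open import Data.Product using (Σ; _×_; _,_; proj₁; proj₂)
open import Relation.Binary.Core using (Rel)
open import Relation.Binary.Structures using (IsEquivalence)
open import Relation.Binary.PropositionalEquality using (_≡_)
open import Relation.Unary using (Pred; _⊆_)
open import Function.Definitions using (Injective)

record Language : Set₁ where
  field
    Op         : Set
    arity      : Op → ℕ
    nonNullary : ∀ f → 1 ≤ arity f

open Language public

data Term (L : Language) (X : Set) : Set where
  var : X → Term L X
  app : (f : Op L) → Vec (Term L X) (arity L f) → Term L X

mutual
  substT : ∀ {L X Y} → (X → Term L Y) → Term L X → Term L Y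
  substT σ (var x)    = σ x
  substT σ (app f ts) = app f (substTs σ ts)

  substTs : ∀ {L X Y n} → (X → Term L Y) → Vec (Term L X) n → Vec (Term L Y) n
  substTs σ []       = []
  substTs σ (t ∷ ts) = substT σ t ∷ substTs σ ts

-- Logics: substitution-invariant consequence relations on Fm_L(κ),
-- where the variable set {x_α : α < κ} (κ infinite) is an abstract
-- type Var admitting an injection from ℕ.

record Logic : Set₁ where
  field
    lang          : Language
    Var           : Set
    varsInfinite  : Σ (ℕ → Var) (Injective _≡_ _≡_)
    _⊢_           : Pred (Term lang Var) 0ℓ → Term lang Var → Set
    reflexivity   : ∀ {Γ φ} → Γ φ → Γ ⊢ φ
    monotonicity  : ∀ {Γ Δ φ} → Γ ⊢ φ → Γ ⊆ Δ → Δ ⊢ φ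
    cut           : ∀ {Γ Δ φ} → (∀ ψ → Δ ψ → Γ ⊢ ψ) → Δ ⊢ φ → Γ ⊢ φ
    structurality : ∀ {Γ φ} (σ : Var → Term lang Var) → Γ ⊢ φ →
                    (λ χ → Σ (Term lang Var) λ ψ → Γ ψ × substT σ ψ ≡ χ)
                      ⊢ substT σ φ

open Logic public

Fm : Logic → Set
Fm S = Term (lang S) (Var S)

-- Algebras (carrier given as a setoid, so that quotients are available)

record Algebra (L : Language) (ℓ : Level) : Set (lsuc ℓ) where
  field
    Carrier       : Set ℓ
    _≈_           : Rel Carrier ℓ
    isEquivalence : IsEquivalence _≈_
    op            : (f : Op L) → Vec Carrier (arity L f) → Carrier
    op-cong       : ∀ f (xs ys : Vec Carrier (arity L f)) →
                    (∀ i → lookup xs i ≈ lookup ys i) → op f xs ≈ op f ys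

module _ {L : Language} {ℓ : Level} (A : Algebra L ℓ) where
  open Algebra A

  mutual
    eval : ∀ {X : Set} → (X → Carrier) → Term L X → Carrier
    eval ρ (var x)    = ρ x
    eval ρ (app f ts) = op f (evals ρ ts)

    evals : ∀ {X : Set} {n} → (X → Carrier) → Vec (Term L X) n → Vec Carrier n
    evals ρ []       = []
    evals ρ (t ∷ ts) = eval ρ t ∷ evals ρ ts

  private module E = IsEquivalence isEquivalence

  mutual
    eval-cong : ∀ {X : Set} (ρ ρ' : X → Carrier) → (∀ x → ρ x ≈ ρ' x) →
                ∀ t → eval ρ t ≈ eval ρ' t
    eval-cong ρ ρ' e (var x)    = e x
    eval-cong ρ ρ' e (app f ts) =
      op-cong f (evals ρ ts) (evals ρ' ts) (evals-cong ρ ρ' e ts)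

    evals-cong : ∀ {X : Set} {n} (ρ ρ' : X → Carrier) → (∀ x → ρ x ≈ ρ' x) →
                 (ts : Vec (Term L X) n) →
                 ∀ i → lookup (evals ρ ts) i ≈ lookup (evals ρ' ts) i
    evals-cong ρ ρ' e (t ∷ ts) zero    = eval-cong ρ ρ' e t
    evals-cong ρ ρ' e (t ∷ ts) (suc i) = evals-cong ρ ρ' e ts i

  record IsCongruence (θ : Rel Carrier ℓ) : Set ℓ where
    field
      ≈⊆θ           : ∀ {a b} → a ≈ b → θ a b
      isEquivalence : IsEquivalence θ
      op-cong       : ∀ f (xs ys : Vec Carrier (arity L f)) →
                      (∀ i → θ (lookup xs i) (lookup ys i)) →
                      θ (op f xs) (op f ys)

  Compatible : Rel Carrier ℓ → Pred Carrier ℓ → Set ℓ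
  Compatible θ F = ∀ {a b} → θ a b → F a → F b

  IsLeibniz : Pred Carrier ℓ → Rel Carrier ℓ → Set (lsuc ℓ)
  IsLeibniz F θ = IsCongruence θ × Compatible θ F ×
    (∀ (θ' : Rel Carrier ℓ) → IsCongruence θ' → Compatible θ' F →
       ∀ {a b} → θ' a b → θ a b)

  quotient : (θ : Rel Carrier ℓ) → IsCongruence θ → Algebra L ℓ
  quotient θ c = record
    { Carrier = Carrier ; _≈_ = θ
    ; isEquivalence = IsCongruence.isEquivalence c
    ; op = op ; op-cong = IsCongruence.op-cong c }

record Matrix (L : Language) (ℓ : Level) : Set (lsuc ℓ) where
  field
    alg    : Algebra L ℓ
    F      : Pred (Algebra.Carrier alg) ℓ
    F-resp : ∀ {a b} → Algebra._≈_ alg a b → F a → F b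

record _≅_ {L : Language} {ℓ : Level} (M N : Matrix L ℓ) : Set ℓ where
  private
    module A = Algebra (Matrix.alg M)
    module B = Algebra (Matrix.alg N)
  field
    to       : A.Carrier → B.Carrier
    from     : B.Carrier → A.Carrier
    to-cong  : ∀ {a a'} → a A.≈ a' → to a B.≈ to a'
    from-cong : ∀ {b b'} → b B.≈ b' → from b A.≈ from b'
    to-from  : ∀ b → to (from b) B.≈ b
    from-to  : ∀ a → from (to a) A.≈ a
    to-hom   : ∀ f xs → to (A.op f xs) B.≈ B.op f (map to xs)
    to-F     : ∀ a → Matrix.F M a → Matrix.F N (to a)
    to-F-onto : ∀ b → Matrix.F N b → Σ A.Carrier λ a → Matrix.F M a × to a B.≈ b

quotientMatrix : ∀ {L ℓ} (M : Matrix L ℓ) (θ : Rel (Algebra.Carrier (Matrix.alg M)) ℓ) →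
                 IsCongruence (Matrix.alg M) θ → Matrix L ℓ
quotientMatrix M θ c = record
  { alg = quotient (Matrix.alg M) θ c
  ; F = λ a → Σ (Algebra.Carrier (Matrix.alg M)) λ b → Matrix.F M b × θ b a
  ; F-resp = λ { e (b , Fb , θba) → b , Fb , IsEquivalence.trans (IsCongruence.isEquivalence c) θba e } }

ℝ : ∀ {L ℓ k} → (Matrix L ℓ → Set k) → Matrix L ℓ → Set (lsuc ℓ ⊔ k)
ℝ {L} {ℓ} K N = Σ (Matrix L ℓ) λ M → K M ×
  Σ (Rel (Algebra.Carrier (Matrix.alg M)) ℓ) λ θ →
  Σ (IsLeibniz (Matrix.alg M) (Matrix.F M) θ) λ lb →
    N ≅ quotientMatrix M θ (proj₁ lb)

module _ (S : Logic) {ℓ : Level} (A : Algebra (lang S) ℓ) where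
  open Algebra A

  IsHom : (Fm S → Carrier) → Set ℓ
  IsHom h = ∀ f ts → h (app f ts) ≈ op f (map h ts)

  IsDeductiveFilter : Pred Carrier ℓ → Set (lsuc 0ℓ ⊔ ℓ)
  IsDeductiveFilter F = ∀ (Γ : Pred (Fm S) 0ℓ) φ → _⊢_ S Γ φ →
    ∀ (h : Fm S → Carrier) → IsHom h → (∀ ψ → Γ ψ → F (h ψ)) → F (h φ)

  -- Ω̃^A_S F is the identity (i.e. contained in the setoid equality)
  TildeLeibnizIsIdentity : Pred Carrier ℓ → Set (lsuc ℓ)
  TildeLeibnizIsIdentity F = ∀ a b →
    (∀ (G : Pred Carrier ℓ) → (∀ {x y} → x ≈ y → G x → G y) →
       IsDeductiveFilter G → F ⊆ G →
       ∀ (θ : Rel Carrier ℓ) → IsLeibniz A G θ → θ a b) →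
    a ≈ b

Mod : (S : Logic) {ℓ : Level} → Matrix (lang S) ℓ → Set (lsuc 0ℓ ⊔ ℓ)
Mod S M = IsDeductiveFilter S (Matrix.alg M) (Matrix.F M)

Mod≡ : (S : Logic) {ℓ : Level} → Matrix (lang S) ℓ → Set (lsuc ℓ)
Mod≡ S M = Mod S M × TildeLeibnizIsIdentity S (Matrix.alg M) (Matrix.F M)

Translation : Language → Language → Set
Translation L L' = (f : Op L) → Term L' (Fin (arity L f))

_^_ : ∀ {L L' ℓ} → Algebra L' ℓ → Translation L L' → Algebra L ℓ
A ^ τ = record
  { Carrier = Carrier ; _≈_ = _≈_ ; isEquivalence = isEquivalence
  ; op = λ f xs → eval A (lookup xs) (τ f)
  ; op-cong = λ f xs ys e → eval-cong A (lookup xs) (lookup ys) e (τ f) }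
  where open Algebra A

_^ᴹ_ : ∀ {L L' ℓ} → Matrix L' ℓ → Translation L L' → Matrix L ℓ
M ^ᴹ τ = record { alg = Matrix.alg M ^ τ ; F = Matrix.F M ; F-resp = Matrix.F-resp M }

IsInterpretation : (ℓ : Level) (S S' : Logic) → Translation (lang S) (lang S') → Set (lsuc ℓ)
IsInterpretation ℓ S S' τ = ∀ (M : Matrix (lang S') ℓ) → Mod≡ S' M → Mod≡ S (M ^ᴹ τ)

-- (⇒) A quotient of a model by its Leibniz congruence lies in Mod≡(S'), and
--     Mod≡ is invariant under isomorphism; so ℝ(Mod S') ⊆ Mod≡(S'), and an
--     interpretation maps it into Mod≡(S).
-- (⇐) Let ⟨A, F⟩ ∈ Mod≡(S').  For every S'-filter G ⊇ F with Leibniz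
--     congruence θ the reduction ⟨A/θ, G/θ⟩ lies in ℝ(Mod S'), so by hypothesis
--     its τ-translation is in Mod≡(S).  Taking G = F shows that F is an S-filter
--     of A^τ; for the Suszko part, the Leibniz congruence of an S-filter H of
--     (A/θ)^τ computed in A^τ is also its Leibniz congruence in (A/θ)^τ.
module Submission where

open import Defs
open import Level using (Level)
open import Function using (_∘_; id)
open import Function.Bundles using (_⇔_; mk⇔)
open import Data.Fin using (Fin; zero; suc)
open import Data.Vec using (Vec; []; _∷_; lookup; map; tabulate)
open import Data.Vec.Properties using (lookup-map; map-id; map-∘)
open import Data.Product using (Σ; _×_; _,_; proj₁; proj₂)
open import Data.Sum using (_⊎_; inj₁; inj₂; [_,_])
open import Relation.Binary.Core using (Rel)
open import Relation.Binary.Structures using (IsEquivalence)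
open import Relation.Binary.PropositionalEquality using (_≡_; refl; sym; trans; cong; cong₂)
open import Relation.Unary using (Pred; _⊆_)

module Evaluation {L : Language} {ℓ : Level} (A : Algebra L ℓ) where
  open Algebra A
  private module E = IsEquivalence isEquivalence

  ≡⇒≈ : ∀ {a b} → a ≡ b → a ≈ b
  ≡⇒≈ refl = E.refl

  mutual
    eval-subst : ∀ {X Y : Set} (α : Y → Carrier) (g : X → Term L Y) (t : Term L X) →
                 eval A α (substT g t) ≡ eval A (λ x → eval A α (g x)) t
    eval-subst α g (var x)    = refl
    eval-subst α g (app f ts) = cong (op f) (evals-subst α g ts)

    evals-subst : ∀ {X Y : Set} {n} (α : Y → Carrier) (g : X → Term L Y) (ts : Vec (Term L X) n) →
                  evals A α (substTs g ts) ≡ evals A (λ x → eval A α (g x)) ts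
    evals-subst α g []       = refl
    evals-subst α g (t ∷ ts) = cong₂ _∷_ (eval-subst α g t) (evals-subst α g ts)

  eval-subst-≈ : ∀ {X Y : Set} (α : Y → Carrier) (g : X → Term L Y) (β : X → Carrier) →
                 (∀ x → eval A α (g x) ≈ β x) → ∀ t → eval A α (substT g t) ≈ eval A β t
  eval-subst-≈ α g β pw t = E.trans (≡⇒≈ (eval-subst α g t)) (eval-cong A _ β pw t)

  evals-map : ∀ {X : Set} {n} (ρ : X → Carrier) (ts : Vec (Term L X) n) →
              evals A ρ ts ≡ map (eval A ρ) ts
  evals-map ρ []       = refl
  evals-map ρ (t ∷ ts) = cong (eval A ρ t ∷_) (evals-map ρ ts)

  lookup-evals-tabulate : ∀ {X : Set} {n} (ρ : X → Carrier) (g : Fin n → Term L X) (i : Fin n) →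
                          lookup (evals A ρ (tabulate g)) i ≡ eval A ρ (g i)
  lookup-evals-tabulate ρ g zero    = refl
  lookup-evals-tabulate ρ g (suc i) = lookup-evals-tabulate ρ (g ∘ suc) i

  op-map-id : ∀ f (xs : Vec Carrier (arity L f)) → op f xs ≈ op f (map id xs)
  op-map-id f xs = ≡⇒≈ (cong (op f) (sym (map-id xs)))

record IsAlgHom {L : Language} {ℓ : Level} (A B : Algebra L ℓ)
                (g : Algebra.Carrier A → Algebra.Carrier B) : Set ℓ where
  field
    resp : ∀ {a a'} → Algebra._≈_ A a a' → Algebra._≈_ B (g a) (g a')
    hom  : ∀ f xs → Algebra._≈_ B (g (Algebra.op A f xs)) (Algebra.op B f (map g xs))

module _ {L : Language} {ℓ : Level} {A B : Algebra L ℓ} {g : Algebra.Carrier A → Algebra.Carrier B}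
         (g-hom : IsAlgHom A B g) where
  private
    module A = Algebra A
    module B = Algebra B
    module EB = IsEquivalence B.isEquivalence
  open IsAlgHom g-hom

  mutual
    hom-eval : ∀ {X : Set} (ρ : X → A.Carrier) t → g (eval A ρ t) B.≈ eval B (g ∘ ρ) t
    hom-eval ρ (var x)    = EB.refl
    hom-eval ρ (app f ts) = EB.trans (hom f (evals A ρ ts)) (B.op-cong f _ _ (hom-evals ρ ts))

    hom-evals : ∀ {X : Set} {n} (ρ : X → A.Carrier) (ts : Vec (Term L X) n) →
                ∀ i → lookup (map g (evals A ρ ts)) i B.≈ lookup (evals B (g ∘ ρ) ts) i
    hom-evals ρ (t ∷ ts) zero    = hom-eval ρ t
    hom-evals ρ (t ∷ ts) (suc i) = hom-evals ρ ts i

  -- A homomorphism A → B is also one between the translated algebras A^τ → B^τ.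
  -- (The source language is given explicitly: τ alone does not determine it.)
  translate-hom : ∀ {L' : Language} (τ : Translation L' L) → IsAlgHom {L'} {ℓ} (A ^ τ) (B ^ τ) g
  translate-hom τ = record
    { resp = resp
    ; hom  = λ f xs → EB.trans (hom-eval (lookup xs) (τ f))
                        (eval-cong B _ _ (λ i → Evaluation.≡⇒≈ B (sym (lookup-map i g xs))) (τ f)) }

  pullback-congruence : ∀ {θ : Rel B.Carrier ℓ} → IsCongruence B θ →
                        IsCongruence A (λ x y → θ (g x) (g y))
  pullback-congruence {θ} c = record
    { ≈⊆θ           = C.≈⊆θ ∘ resp
    ; isEquivalence = record { refl = Θ.refl ; sym = Θ.sym ; trans = Θ.trans }
    ; op-cong       = λ f xs ys pw →
        Θ.trans (C.≈⊆θ (hom f xs))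
          (Θ.trans (C.op-cong f _ _ (λ i → lookup-map-θ (lookup-map i g xs) (lookup-map i g ys) (pw i)))
            (Θ.sym (C.≈⊆θ (hom f ys)))) }
    where
    module C = IsCongruence c
    module Θ = IsEquivalence C.isEquivalence
    lookup-map-θ : ∀ {u v u' v'} → u ≡ u' → v ≡ v' → θ u' v' → θ u v
    lookup-map-θ refl refl w = w

module _ (T : Logic) {ℓ : Level} {A B : Algebra (lang T) ℓ} {g : Algebra.Carrier A → Algebra.Carrier B}
         (g-hom : IsAlgHom A B g) where
  private
    module B = Algebra B
    module EB = IsEquivalence B.isEquivalence
  open IsAlgHom g-hom

  compose-IsHom : ∀ {h} → IsHom T A h → IsHom T B (g ∘ h)
  compose-IsHom {h} h-hom f ts =
    EB.trans (resp (h-hom f ts))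
      (EB.trans (hom f (map h ts))
        (Evaluation.≡⇒≈ B (cong (B.op f) (sym (map-∘ g h ts)))))

  pullback-filter : ∀ {G : Pred B.Carrier ℓ} → IsDeductiveFilter T B G →
                    IsDeductiveFilter T A (G ∘ g)
  pullback-filter G-filter Γ φ Γ⊢φ h h-hom hΓ = G-filter Γ φ Γ⊢φ (g ∘ h) (compose-IsHom h-hom) hΓ

module _ (T : Logic) {ℓ : Level} (A : Algebra (lang T) ℓ) where
  open Algebra A
  private module E = IsEquivalence isEquivalence

  mutual
    hom≈eval : ∀ {h} → IsHom T A h → ∀ t → h t ≈ eval A (h ∘ var) t
    hom≈eval h-hom (var x)    = E.refl
    hom≈eval h-hom (app f ts) = E.trans (h-hom f ts) (op-cong f _ _ (homs≈evals h-hom ts))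

    homs≈evals : ∀ {h n} → IsHom T A h → (ts : Vec (Fm T) n) →
                 ∀ i → lookup (map h ts) i ≈ lookup (evals A (h ∘ var) ts) i
    homs≈evals h-hom (t ∷ ts) zero    = hom≈eval h-hom t
    homs≈evals h-hom (t ∷ ts) (suc i) = homs≈evals h-hom ts i

  eval-isHom : ∀ ρ → IsHom T A (eval A ρ)
  eval-isHom ρ f ts = Evaluation.≡⇒≈ A (cong (op f) (Evaluation.evals-map A ρ ts))

module Quotient {L : Language} {ℓ : Level} (A : Algebra L ℓ)
                {θ : Rel (Algebra.Carrier A) ℓ} (c : IsCongruence A θ) where
  open Algebra A
  private module Θ = IsEquivalence (IsCongruence.isEquivalence c)

  quotient-map : IsAlgHom A (quotient A θ c) id
  quotient-map = record
    { resp = IsCongruence.≈⊆θ c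
    ; hom  = λ f xs → IsCongruence.≈⊆θ c (Evaluation.op-map-id A f xs) }

  eval-resp-congruence : ∀ {X : Set} (ρ ρ' : X → Carrier) → (∀ x → θ (ρ x) (ρ' x)) →
                         ∀ t → θ (eval A ρ t) (eval A ρ' t)
  eval-resp-congruence ρ ρ' pw t =
    Θ.trans (hom-eval quotient-map ρ t)
      (Θ.trans (eval-cong (quotient A θ c) ρ ρ' pw t) (Θ.sym (hom-eval quotient-map ρ' t)))

-- Existence of the Leibniz congruence
--
-- Ω^A H relates a and b when every unary polynomial (a term with one distinguished
-- variable and parameters from A) sends a into H iff it sends b into H.

-- Variables of unary polynomials: the distinguished variable and two disjoint
-- copies of the whole set, so that two parameter assignments can be merged.
data Code : Set where
  here        : Code
  left right  : Code → Code

module LeibnizCongruence {L : Language} {ℓ : Level} (A : Algebra L ℓ)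
                         (H : Pred (Algebra.Carrier A) ℓ)
                         (H-resp : ∀ {a b} → Algebra._≈_ A a b → H a → H b) where
  open Algebra A
  open Evaluation A
  private module E = IsEquivalence isEquivalence

  _◂_ : Carrier → (Code → Carrier) → Code → Carrier
  (a ◂ ρ) here      = a
  (a ◂ ρ) (left x)  = ρ (left x)
  (a ◂ ρ) (right x) = ρ (right x)

  Below : Rel Carrier ℓ
  Below a b = ∀ (t : Term L Code) (ρ : Code → Carrier) → H (eval A (a ◂ ρ) t) → H (eval A (b ◂ ρ) t)

  Ω : Rel Carrier ℓ
  Ω a b = Below a b × Below b a

  below-≈ : ∀ {a b} → a ≈ b → Below a b
  below-≈ {a} {b} a≈b t ρ = H-resp (eval-cong A (a ◂ ρ) (b ◂ ρ) pw t)
    where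
    pw : ∀ x → (a ◂ ρ) x ≈ (b ◂ ρ) x
    pw here      = a≈b
    pw (left x)  = E.refl
    pw (right x) = E.refl

  Ω-≈ : ∀ {a b} → a ≈ b → Ω a b
  Ω-≈ a≈b = below-≈ a≈b , below-≈ (E.sym a≈b)

  Ω-sym : ∀ {a b} → Ω a b → Ω b a
  Ω-sym (p , q) = q , p

  Ω-trans : ∀ {a b c} → Ω a b → Ω b c → Ω a c
  Ω-trans (p , q) (p' , q') = (λ t ρ → p' t ρ ∘ p t ρ) , (λ t ρ → q t ρ ∘ q' t ρ)

  Ω-resp : ∀ {a a' b b'} → a ≈ a' → b ≈ b' → Ω a b → Ω a' b'
  Ω-resp a≈a' b≈b' w = Ω-trans (Ω-≈ (E.sym a≈a')) (Ω-trans w (Ω-≈ b≈b'))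

  -- Below is preserved by unary polynomials: substitute the polynomial s into the
  -- distinguished variable of a test polynomial t, keeping the parameters apart.
  below-poly : ∀ {c d} → Below c d → ∀ (s : Term L Code) (ρ : Code → Carrier) →
               Below (eval A (c ◂ ρ) s) (eval A (d ◂ ρ) s)
  below-poly {c} {d} c≤d s ρ t σ Hc =
    H-resp (composed d) (c≤d (substT g t) κ (H-resp (E.sym (composed c)) Hc))
    where
    toRight : Code → Term L Code
    toRight here      = var here
    toRight (left x)  = var (right (left x))
    toRight (right x) = var (right (right x))
    g : Code → Term L Code
    g here      = substT toRight s
    g (left x)  = var (left (left x))
    g (right x) = var (left (right x))
    κ : Code → Carrier
    κ here      = c
    κ (left y)  = σ y
    κ (right y) = ρ y
    composed : ∀ e → eval A (e ◂ κ) (substT g t) ≈ eval A (eval A (e ◂ ρ) s ◂ σ) t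
    composed e = eval-subst-≈ (e ◂ κ) g _ pw t
      where
      pw-s : ∀ x → eval A (e ◂ κ) (toRight x) ≈ (e ◂ ρ) x
      pw-s here      = E.refl
      pw-s (left x)  = E.refl
      pw-s (right x) = E.refl
      pw : ∀ x → eval A (e ◂ κ) (g x) ≈ (eval A (e ◂ ρ) s ◂ σ) x
      pw here      = eval-subst-≈ (e ◂ κ) toRight (e ◂ ρ) pw-s s
      pw (left x)  = E.refl
      pw (right x) = E.refl

  Ω-poly : ∀ {c d} → Ω c d → ∀ (s : Term L Code) (ρ : Code → Carrier) →
           Ω (eval A (c ◂ ρ) s) (eval A (d ◂ ρ) s)
  Ω-poly (p , q) s ρ = below-poly p s ρ , below-poly q s ρ

  encode : ∀ {k} → Fin k → Code
  encode zero    = here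
  encode (suc i) = left (encode i)

  vecAssignment : ∀ {k} → Vec Carrier k → Carrier → Code → Carrier
  vecAssignment []       d _         = d
  vecAssignment (v ∷ vs) d here      = v
  vecAssignment (v ∷ vs) d (left e)  = vecAssignment vs d e
  vecAssignment (v ∷ vs) d (right e) = d

  vecAssignment-encode : ∀ {k} (vs : Vec Carrier k) d (i : Fin k) →
                         vecAssignment vs d (encode i) ≡ lookup vs i
  vecAssignment-encode (v ∷ vs) d zero    = refl
  vecAssignment-encode (v ∷ vs) d (suc i) = vecAssignment-encode vs d i

  -- Ω is preserved by k-ary polynomials, changing one argument at a time.
  Ω-poly-vec : ∀ {k} (xs ys : Vec Carrier k) → (∀ i → Ω (lookup xs i) (lookup ys i)) →
               ∀ (t : Term L (Fin k ⊎ Code)) (ρ : Code → Carrier) →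
               Ω (eval A [ lookup xs , ρ ] t) (eval A [ lookup ys , ρ ] t)
  Ω-poly-vec [] [] pw t ρ = Ω-≈ (eval-cong A _ _ (λ { (inj₂ c) → E.refl }) t)
  Ω-poly-vec (x ∷ xs) (y ∷ ys) pw t ρ = Ω-trans change-head change-tail
    where
    -- the head becomes the distinguished variable, the tail a parameter
    headHere : Fin _ ⊎ Code → Term L Code
    headHere (inj₁ zero)    = var here
    headHere (inj₁ (suc i)) = var (left (encode i))
    headHere (inj₂ c)       = var (right c)
    ρ₁ : Code → Carrier
    ρ₁ here      = x
    ρ₁ (left e)  = vecAssignment xs x e
    ρ₁ (right c) = ρ c
    as-unary : ∀ e → eval A (e ◂ ρ₁) (substT headHere t) ≈ eval A [ lookup (e ∷ xs) , ρ ] t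
    as-unary e = eval-subst-≈ _ headHere _ pw₁ t
      where
      pw₁ : ∀ z → eval A (e ◂ ρ₁) (headHere z) ≈ [ lookup (e ∷ xs) , ρ ] z
      pw₁ (inj₁ zero)    = E.refl
      pw₁ (inj₁ (suc i)) = ≡⇒≈ (vecAssignment-encode xs x i)
      pw₁ (inj₂ c)       = E.refl
    change-head : Ω (eval A [ lookup (x ∷ xs) , ρ ] t) (eval A [ lookup (y ∷ xs) , ρ ] t)
    change-head = Ω-resp (as-unary x) (as-unary y) (Ω-poly (pw zero) (substT headHere t) ρ₁)
    -- the head becomes a parameter, the tail stays variable
    headParam : Fin _ ⊎ Code → Term L (Fin _ ⊎ Code)
    headParam (inj₁ zero)    = var (inj₂ here)
    headParam (inj₁ (suc i)) = var (inj₁ i)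
    headParam (inj₂ c)       = var (inj₂ (left c))
    ρ₂ : Code → Carrier
    ρ₂ here      = y
    ρ₂ (left c)  = ρ c
    ρ₂ (right c) = y
    as-tail : ∀ zs → eval A [ lookup zs , ρ₂ ] (substT headParam t) ≈ eval A [ lookup (y ∷ zs) , ρ ] t
    as-tail zs = eval-subst-≈ _ headParam _ pw₂ t
      where
      pw₂ : ∀ z → eval A [ lookup zs , ρ₂ ] (headParam z) ≈ [ lookup (y ∷ zs) , ρ ] z
      pw₂ (inj₁ zero)    = E.refl
      pw₂ (inj₁ (suc i)) = E.refl
      pw₂ (inj₂ c)       = E.refl
    change-tail : Ω (eval A [ lookup (y ∷ xs) , ρ ] t) (eval A [ lookup (y ∷ ys) , ρ ] t)
    change-tail = Ω-resp (as-tail xs) (as-tail ys)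
                    (Ω-poly-vec xs ys (pw ∘ suc) (substT headParam t) ρ₂)

  Ω-op : ∀ f (xs ys : Vec Carrier (arity L f)) → (∀ i → Ω (lookup xs i) (lookup ys i)) →
         Ω (op f xs) (op f ys)
  Ω-op f xs ys pw = Ω-resp (E.sym (as-term xs)) (E.sym (as-term ys)) (Ω-poly-vec xs ys pw u ρ)
    where
    u : Term L (Fin (arity L f) ⊎ Code)
    u = app f (tabulate (var ∘ inj₁))
    ρ : Code → Carrier
    ρ _ = op f xs
    as-term : ∀ zs → op f zs ≈ eval A [ lookup zs , ρ ] u
    as-term zs = op-cong f _ _ (λ i → ≡⇒≈ (sym (lookup-evals-tabulate _ (var ∘ inj₁) i)))

  Ω-isCongruence : IsCongruence A Ω
  Ω-isCongruence = record
    { ≈⊆θ           = Ω-≈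
    ; isEquivalence = record { refl = Ω-≈ E.refl ; sym = Ω-sym ; trans = Ω-trans }
    ; op-cong       = Ω-op }

  -- the identity polynomial
  Ω-compatible : Compatible A Ω H
  Ω-compatible {a} (p , _) = p (var here) (λ _ → a)

  -- a compatible congruence is preserved by every polynomial, so it lies below Ω
  Ω-largest : ∀ (θ : Rel Carrier ℓ) → IsCongruence A θ → Compatible A θ H →
              ∀ {a b} → θ a b → Ω a b
  Ω-largest θ c compat {a} {b} w = below a b w , below b a (Θ.sym w)
    where
    module Θ = IsEquivalence (IsCongruence.isEquivalence c)
    below : ∀ a b → θ a b → Below a b
    below a b w t ρ = compat (Quotient.eval-resp-congruence A c (a ◂ ρ) (b ◂ ρ) pw t)
      where
      pw : ∀ x → θ ((a ◂ ρ) x) ((b ◂ ρ) x)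
      pw here      = w
      pw (left x)  = Θ.refl
      pw (right x) = Θ.refl

  Ω-isLeibniz : IsLeibniz A H Ω
  Ω-isLeibniz = Ω-isCongruence , Ω-compatible , Ω-largest

-- Mod≡ is invariant under isomorphism of matrices

module Isomorphism {L : Language} {ℓ : Level} {M N : Matrix L ℓ} (iso : M ≅ N) where
  private
    A = Matrix.alg M
    B = Matrix.alg N
    module A = Algebra A
    module B = Algebra B
    module EA = IsEquivalence A.isEquivalence
    module EB = IsEquivalence B.isEquivalence
  open _≅_ iso

  to-isAlgHom : IsAlgHom A B to
  to-isAlgHom = record { resp = to-cong ; hom = to-hom }

  -- from (op us) ≈ from (op (map to (map from us))) ≈ from (to (op (map from us))) ≈ op (map from us)
  from-isAlgHom : IsAlgHom B A from
  from-isAlgHom = record { resp = from-cong ; hom = from-hom }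
    where
    to-from-pointwise : ∀ {n} (us : Vec B.Carrier n) i → lookup us i B.≈ lookup (map to (map from us)) i
    to-from-pointwise us i =
      EB.sym (EB.trans (Evaluation.≡⇒≈ B (trans (lookup-map i to (map from us)) (cong to (lookup-map i from us))))
                       (to-from (lookup us i)))
    from-hom : ∀ f us → from (B.op f us) A.≈ A.op f (map from us)
    from-hom f us =
      EA.trans (from-cong (EB.trans (B.op-cong f _ _ (to-from-pointwise us)) (EB.sym (to-hom f (map from us)))))
               (from-to _)

  to-reflects-≈ : ∀ {a a'} → to a B.≈ to a' → a A.≈ a'
  to-reflects-≈ e = EA.trans (EA.sym (from-to _)) (EA.trans (from-cong e) (from-to _))

  to-reflects-F : ∀ {a} → Matrix.F N (to a) → Matrix.F M a
  to-reflects-F Fa with to-F-onto _ Fa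
  ... | a' , Fa' , e = Matrix.F-resp M (to-reflects-≈ e) Fa'

  pullback-Leibniz : ∀ {G' : Pred B.Carrier ℓ} → (∀ {x y} → x B.≈ y → G' x → G' y) →
                     ∀ {θ' : Rel B.Carrier ℓ} → IsLeibniz B G' θ' →
                     IsLeibniz A (G' ∘ to) (λ x y → θ' (to x) (to y))
  pullback-Leibniz {G'} G'-resp {θ'} (c' , compat' , largest') =
    pullback-congruence to-isAlgHom c' , compat' , largest
    where
    largest : ∀ (θ : Rel A.Carrier ℓ) → IsCongruence A θ → Compatible A θ (G' ∘ to) →
              ∀ {x y} → θ x y → θ' (to x) (to y)
    largest θ c compat {x} {y} w = largest' ψ (pullback-congruence from-isAlgHom c) ψ-compat ψ-to
      where
      module Θ = IsEquivalence (IsCongruence.isEquivalence c)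
      ψ : Rel B.Carrier ℓ
      ψ u v = θ (from u) (from v)
      ψ-compat : Compatible B ψ G'
      ψ-compat {u} {v} w' = G'-resp (to-from v) ∘ compat w' ∘ G'-resp (EB.sym (to-from u))
      ψ-to : ψ (to x) (to y)
      ψ-to = Θ.trans (IsCongruence.≈⊆θ c (from-to x)) (Θ.trans w (IsCongruence.≈⊆θ c (EA.sym (from-to y))))

transport-Mod≡ : (T : Logic) {ℓ : Level} {M N : Matrix (lang T) ℓ} → M ≅ N → Mod≡ T N → Mod≡ T M
transport-Mod≡ T {M = M} {N} iso (N-model , N-suszko) = M-model , M-suszko
  where
  open _≅_ iso
  open Isomorphism iso
  module B = Algebra (Matrix.alg N)

  M-model : Mod T M
  M-model Γ φ Γ⊢φ h h-hom hΓ =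
    to-reflects-F (N-model Γ φ Γ⊢φ (to ∘ h) (compose-IsHom T to-isAlgHom h-hom) (λ ψ → to-F (h ψ) ∘ hΓ ψ))

  -- filters and Leibniz congruences of N pull back to those of M
  M-suszko : TildeLeibnizIsIdentity T (Matrix.alg M) (Matrix.F M)
  M-suszko a b hyp = to-reflects-≈ (N-suszko (to a) (to b) hyp')
    where
    hyp' : ∀ (G' : Pred B.Carrier _) → (∀ {x y} → x B.≈ y → G' x → G' y) →
           IsDeductiveFilter T (Matrix.alg N) G' → Matrix.F N ⊆ G' →
           ∀ (θ' : Rel B.Carrier _) → IsLeibniz (Matrix.alg N) G' θ' → θ' (to a) (to b)
    hyp' G' G'-resp G'-filter F⊆G' θ' θ'-Leibniz =
      hyp (G' ∘ to) (G'-resp ∘ to-cong) (pullback-filter T to-isAlgHom {G'} G'-filter) (F⊆G' ∘ to-F _)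
          (λ x y → θ' (to x) (to y)) (pullback-Leibniz G'-resp θ'-Leibniz)

≅-refl : ∀ {L : Language} {ℓ : Level} (M : Matrix L ℓ) → M ≅ M
≅-refl M = record
  { to = id ; from = id ; to-cong = id ; from-cong = id
  ; to-from = λ _ → E.refl ; from-to = λ _ → E.refl
  ; to-hom = Evaluation.op-map-id (Matrix.alg M)
  ; to-F = λ _ → id ; to-F-onto = λ b Fb → b , Fb , E.refl }
  where module E = IsEquivalence (Algebra.isEquivalence (Matrix.alg M))

module Reduction (T : Logic) {ℓ : Level} (M : Matrix (lang T) ℓ) where
  private
    A = Matrix.alg M
    F = Matrix.F M
  open Algebra A

  -- Quotienting a model by a congruence compatible with its filter yields a model:
  -- a homomorphism into A/θ agrees modulo θ with an evaluation in A.
  quotient-model : Mod T M → ∀ {θ} (c : IsCongruence A θ) → Compatible A θ F →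
                   Mod T (quotientMatrix M θ c)
  quotient-model M-model {θ} c compat Γ φ Γ⊢φ h h-hom hΓ =
    eval A ρ φ , M-model Γ φ Γ⊢φ (eval A ρ) (eval-isHom T A ρ) hΓ' , Θ.sym (lift φ)
    where
    module Θ = IsEquivalence (IsCongruence.isEquivalence c)
    ρ : Var T → Carrier
    ρ = h ∘ var
    lift : ∀ t → θ (h t) (eval A ρ t)
    lift t = Θ.trans (hom≈eval T (quotient A θ c) h-hom t)
                     (Θ.sym (hom-eval (Quotient.quotient-map A c) ρ t))
    hΓ' : ∀ ψ → Γ ψ → F (eval A ρ ψ)
    hΓ' ψ Γψ with hΓ ψ Γψ
    ... | b , Fb , θb = compat (Θ.trans θb (lift ψ)) Fb

  quotient-isLeibniz : ∀ {θ} (θ-Leibniz : IsLeibniz A F θ) →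
                       let c = proj₁ θ-Leibniz in
                       IsLeibniz (quotient A θ c) (Matrix.F (quotientMatrix M θ c)) θ
  quotient-isLeibniz {θ} (c , compat , largest) = c-quotient , compat-quotient , largest-quotient
    where
    module Θ = IsEquivalence (IsCongruence.isEquivalence c)
    c-quotient : IsCongruence (quotient A θ c) θ
    c-quotient = record { ≈⊆θ = id ; isEquivalence = IsCongruence.isEquivalence c
                        ; op-cong = IsCongruence.op-cong c }
    compat-quotient : Compatible (quotient A θ c) θ (Matrix.F (quotientMatrix M θ c))
    compat-quotient w (b , Fb , θb) = b , Fb , Θ.trans θb w
    largest-quotient : ∀ θ' → IsCongruence (quotient A θ c) θ' →
                       Compatible (quotient A θ c) θ' (Matrix.F (quotientMatrix M θ c)) →
                       ∀ {a b} → θ' a b → θ a b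
    largest-quotient θ' c' compat' =
      largest θ' (pullback-congruence (Quotient.quotient-map A c) c') compat-F
      where
      compat-F : Compatible A θ' F
      compat-F {x} w Fx with compat' w (x , Fx , Θ.refl)
      ... | b , Fb , θb = compat θb Fb

  reduced-Mod≡ : Mod T M → ∀ {θ} (θ-Leibniz : IsLeibniz A F θ) →
                 Mod≡ T (quotientMatrix M θ (proj₁ θ-Leibniz))
  reduced-Mod≡ M-model {θ} θ-Leibniz@(c , compat , _) =
    Q-model , λ a b hyp → hyp (Matrix.F Q) (Matrix.F-resp Q) Q-model id θ (quotient-isLeibniz θ-Leibniz)
    where
    Q = quotientMatrix M θ c
    Q-model : Mod T Q
    Q-model = quotient-model M-model c compat

ℝMod⊆Mod≡ : (T : Logic) {ℓ : Level} (N : Matrix (lang T) ℓ) → ℝ (Mod T) N → Mod≡ T N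
ℝMod⊆Mod≡ T N (M , M-model , θ , θ-Leibniz , iso) =
  transport-Mod≡ T iso (Reduction.reduced-Mod≡ T M M-model θ-Leibniz)

module TranslatedQuotient {L L' : Language} (τ : Translation L L') {ℓ : Level} (A : Algebra L' ℓ)
                          {θ : Rel (Algebra.Carrier A) ℓ} (c : IsCongruence A θ) where
  Q : Algebra L' ℓ
  Q = quotient A θ c

  -- (the signature gives the source language explicitly: τ alone does not determine it)
  Aᵗ Qᵗ : Algebra L ℓ
  Aᵗ = A ^ τ
  Qᵗ = Q ^ τ

  private
    module Θ = IsEquivalence (IsCongruence.isEquivalence c)

  translated-quotient-map : IsAlgHom Aᵗ Qᵗ id
  translated-quotient-map = translate-hom (Quotient.quotient-map A c) τ

  translate-congruence : IsCongruence Aᵗ θ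
  translate-congruence = record
    { ≈⊆θ = IsCongruence.≈⊆θ c ; isEquivalence = IsCongruence.isEquivalence c
    ; op-cong = λ f xs ys pw → Quotient.eval-resp-congruence A c (lookup xs) (lookup ys) pw (τ f) }

  congruence-descends : ∀ {χ} → IsCongruence Aᵗ χ → (∀ {x y} → θ x y → χ x y) →
                        IsCongruence Qᵗ χ
  congruence-descends {χ} χ-cong θ⊆χ = record
    { ≈⊆θ = θ⊆χ ; isEquivalence = IsCongruence.isEquivalence χ-cong
    ; op-cong = λ f xs ys pw →
        X.trans (θ⊆χ (Θ.sym (to-quotient f xs)))
          (X.trans (IsCongruence.op-cong χ-cong f xs ys pw) (θ⊆χ (to-quotient f ys))) }
    where
    module X = IsEquivalence (IsCongruence.isEquivalence χ-cong)
    to-quotient : ∀ f (xs : Vec (Algebra.Carrier A) (arity L f)) → θ (eval A (lookup xs) (τ f)) (eval Q (lookup xs) (τ f))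
    to-quotient f xs = hom-eval (Quotient.quotient-map A c) (lookup xs) (τ f)

  leibniz-descends : ∀ {H : Pred (Algebra.Carrier A) ℓ} → (∀ {x y} → θ x y → H x → H y) →
                     ∀ {χ} → IsLeibniz Aᵗ H χ → IsLeibniz Qᵗ H χ
  leibniz-descends H-resp (χ-cong , compat , largest) =
    congruence-descends χ-cong (largest _ translate-congruence H-resp) , compat ,
    λ ψ ψ-cong → largest ψ (pullback-congruence translated-quotient-map ψ-cong)

module Backward (S S' : Logic) (τ : Translation (lang S) (lang S')) {ℓ : Level}
                (reduced : ∀ (N : Matrix (lang S') ℓ) → ℝ (Mod S') N → Mod≡ S (N ^ᴹ τ))
                (M : Matrix (lang S') ℓ) where
  private
    A = Matrix.alg M
    F = Matrix.F M
    module EA = IsEquivalence (Algebra.isEquivalence A)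
  open Algebra A using (Carrier; _≈_)

  withFilter : (G : Pred Carrier ℓ) → (∀ {x y} → x ≈ y → G x → G y) → Matrix (lang S') ℓ
  withFilter G G-resp = record { alg = A ; F = G ; F-resp = G-resp }

  translated-reduction : ∀ (G : Pred Carrier ℓ) (G-resp : ∀ {x y} → x ≈ y → G x → G y) →
                         IsDeductiveFilter S' A G → ∀ {θ} (θ-Leibniz : IsLeibniz A G θ) →
                         Mod≡ S (quotientMatrix (withFilter G G-resp) θ (proj₁ θ-Leibniz) ^ᴹ τ)
  translated-reduction G G-resp G-filter {θ} θ-Leibniz =
    reduced _ (withFilter G G-resp , G-filter , θ , θ-Leibniz , ≅-refl _)

  -- F is an S-filter of A^τ: apply the hypothesis to ⟨A/Ω F, F/Ω F⟩ and pull back.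
  translated-model : Mod S' M → Mod S (M ^ᴹ τ)
  translated-model M-model Γ φ Γ⊢φ h h-hom hΓ = Ω-compatible (proj₂ (proj₂ hφ∈F/Ω)) (proj₁ (proj₂ hφ∈F/Ω))
    where
    open LeibnizCongruence A F (Matrix.F-resp M)
    open TranslatedQuotient τ A Ω-isCongruence using (translated-quotient-map)
    hφ∈F/Ω : Σ Carrier λ b → F b × Ω b (h φ)
    hφ∈F/Ω = proj₁ (translated-reduction F (Matrix.F-resp M) M-model Ω-isLeibniz) Γ φ Γ⊢φ h
               (compose-IsHom S translated-quotient-map h-hom) (λ ψ Γψ → h ψ , hΓ ψ Γψ , Ω-≈ EA.refl)

  -- Suszko identity of A^τ: every S'-filter G ⊇ F with Leibniz θ has θ a b, because
  -- every S-filter H ⊇ G/θ of (A/θ)^τ is an S-filter ⊇ F of A^τ whose Leibniz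
  -- congruence there coincides with that in (A/θ)^τ.
  translated-suszko : Mod≡ S' M → TildeLeibnizIsIdentity S (A ^ τ) F
  translated-suszko (_ , M-suszko) a b hyp = M-suszko a b θ-relates
    where
    θ-relates : ∀ (G : Pred Carrier ℓ) (G-resp : ∀ {x y} → x ≈ y → G x → G y) →
                IsDeductiveFilter S' A G → F ⊆ G → ∀ θ → IsLeibniz A G θ → θ a b
    θ-relates G G-resp G-filter F⊆G θ θ-Leibniz =
      proj₂ (translated-reduction G G-resp G-filter θ-Leibniz) a b ψ-relates
      where
      c = proj₁ θ-Leibniz
      open TranslatedQuotient τ A c
      ψ-relates : ∀ (H : Pred Carrier ℓ) → (∀ {x y} → θ x y → H x → H y) → IsDeductiveFilter S Qᵗ H →
                  Matrix.F (quotientMatrix (withFilter G G-resp) θ c) ⊆ H →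
                  ∀ ψ → IsLeibniz Qᵗ H ψ → ψ a b
      ψ-relates H H-resp H-filter G/θ⊆H ψ (_ , _ , ψ-largest) =
        ψ-largest χ (proj₁ χ-Leibniz-Q) (proj₁ (proj₂ χ-Leibniz-Q))
          (hyp H H-≈ (pullback-filter S translated-quotient-map {H} H-filter) F⊆H χ χ-Leibniz)
        where
        H-≈ : ∀ {x y} → x ≈ y → H x → H y
        H-≈ = H-resp ∘ IsCongruence.≈⊆θ c
        F⊆H : F ⊆ H
        F⊆H {x} Fx = G/θ⊆H (x , F⊆G Fx , IsCongruence.≈⊆θ c EA.refl)
        open LeibnizCongruence Aᵗ H H-≈ renaming (Ω to χ; Ω-isLeibniz to χ-Leibniz)
        χ-Leibniz-Q : IsLeibniz Qᵗ H χ
        χ-Leibniz-Q = leibniz-descends H-resp χ-Leibniz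

proposition3p4 : ∀ {ℓ : Level} (S S' : Logic) (τ : Translation (lang S) (lang S')) →
    IsInterpretation ℓ S S' τ ⇔
    (∀ (M : Matrix (lang S') ℓ) → ℝ (Mod S') M → Mod≡ S (M ^ᴹ τ))
proposition3p4 {ℓ} S S' τ = mk⇔ restrict extend
  where
  -- ℝ(Mod S') ⊆ Mod≡(S'), where an interpretation applies
  restrict : IsInterpretation ℓ S S' τ → ∀ M → ℝ (Mod S') M → Mod≡ S (M ^ᴹ τ)
  restrict interpretation M M∈ℝ = interpretation M (ℝMod⊆Mod≡ S' M M∈ℝ)

  extend : (∀ M → ℝ (Mod S') M → Mod≡ S (M ^ᴹ τ)) → IsInterpretation ℓ S S' τ
  extend reduced M M∈Mod≡ = translated-model (proj₁ M∈Mod≡) , translated-suszko M∈Mod≡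
    where open Backward S S' τ reduced M
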